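{- Let $\Gamma$ and $G$ be groups and let $\rho\colon \Gamma\to G$ be a quasi-homomorphism, i.e. a map for which there exists a map $\phi\colon\Gamma\to G$ with $\rho(x)^{ -1}\rho(xy)=\phi(x)\rho(y)\phi(x)^{ -1}$ for all $x,y\in\Gamma$. Let $Z(\rho(\Gamma))$ denote the centralizer of $\rho(\Gamma)$ in $G$. Then for any such $\phi$, the composite $\Gamma\xrightarrow{\phi}G\to G/Z(\rho(\Gamma))$ is a group homomorphism, and this homomorphism $\Gamma\to G/Z(\rho(\Gamma))$ does not depend on the choice of $\phi$.
   Context: $Z(\rho(\Gamma))=\{g\in G: g\rho(\gamma)=\rho(\gamma)g \text{ for all }\gamma\in\Gamma\}$; the quotient $G/Z(\rho(\Gamma))$ is a set of cosets, and the claim includes that $\phi(xy)^{ -1}\phi(x)\phi(y)\in Z(\rho(\Gamma))$ so the induced map is multiplicative. -}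

module Defs where

open import Level using (Level; _⊔_)
open import Algebra.Bundles using (Group)

module _ {a ℓa b ℓb : Level} (Γ : Group a ℓa) (G : Group b ℓb) where
  private
    module Γ = Group Γ
    module G = Group G

  InCentralizer : (Γ.Carrier → G.Carrier) → G.Carrier → Set (a ⊔ ℓb)
  InCentralizer ρ g = ∀ γ → (g G.∙ ρ γ) G.≈ (ρ γ G.∙ g)

  QuasiWitness : (Γ.Carrier → G.Carrier) → (Γ.Carrier → G.Carrier) → Set (a ⊔ ℓb)
  QuasiWitness ρ φ = ∀ x y →
    (ρ x G.⁻¹ G.∙ ρ (x Γ.∙ y)) G.≈ ((φ x G.∙ ρ y) G.∙ φ x G.⁻¹)

  Respects≈ : (Γ.Carrier → G.Carrier) → Set (a ⊔ ℓa ⊔ ℓb)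
  Respects≈ ρ = ∀ {x y} → x Γ.≈ y → ρ x G.≈ ρ y

module Submission where

-- Let ρ : Γ → G be a quasi-homomorphism with witness φ, and write
-- c_g(h) = g h g⁻¹ for conjugation in G.  The defining identity
-- ρ(x)⁻¹ρ(xy) = c_{φ(x)}(ρ(y)) is a twisted multiplicativity rule
--   ρ(xy) = ρ(x) · c_{φ(x)}(ρ(y)).
-- Expanding ρ(x(yz)) and ρ((xy)z) with this rule and cancelling the
-- common factors ρ(x) and c_{φ(x)}(ρ(y)) shows that c_{φ(x)φ(y)} and
-- c_{φ(xy)} agree on ρ(Γ).  Similarly, any two witnesses φ, ψ satisfy
-- c_{φ(x)} = c_{ψ(x)} on ρ(Γ), as both equal y ↦ ρ(x)⁻¹ρ(xy).
-- Both halves of the theorem then follow from one fact about groups: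
-- if c_g(h) = c_k(h) then k⁻¹g commutes with h.

open import Defs
open import Level using (Level)
open import Algebra.Bundles using (Group)
open import Data.Product using (_×_; _,_)
import Algebra.Properties.Group as GroupProperties
import Relation.Binary.Reasoning.Setoid as SetoidReasoning

module Conjugation {b ℓb : Level} (G : Group b ℓb) where
  open Group G
  open GroupProperties G
  open SetoidReasoning setoid

  conj : Carrier → Carrier → Carrier
  conj g h = (g ∙ h) ∙ g ⁻¹

  conj-cong : ∀ g {h h′} → h ≈ h′ → conj g h ≈ conj g h′
  conj-cong g h≈h′ = ∙-congʳ (∙-congˡ h≈h′)

  conj-homo : ∀ g h h′ → conj g (h ∙ h′) ≈ conj g h ∙ conj g h′
  conj-homo g h h′ = begin
    (g ∙ (h ∙ h′)) ∙ g ⁻¹               ≈⟨ ∙-congʳ (assoc g h h′) ⟨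
    ((g ∙ h) ∙ h′) ∙ g ⁻¹               ≈⟨ ∙-congʳ (∙-congʳ (//-rightDividesˡ g (g ∙ h))) ⟨
    ((conj g h ∙ g) ∙ h′) ∙ g ⁻¹        ≈⟨ ∙-congʳ (assoc (conj g h) g h′) ⟩
    (conj g h ∙ (g ∙ h′)) ∙ g ⁻¹        ≈⟨ assoc (conj g h) (g ∙ h′) (g ⁻¹) ⟩
    conj g h ∙ conj g h′                ∎

  conj-action : ∀ g k h → conj (g ∙ k) h ≈ conj g (conj k h)
  conj-action g k h = begin
    ((g ∙ k) ∙ h) ∙ (g ∙ k) ⁻¹          ≈⟨ ∙-congˡ (⁻¹-anti-homo-∙ g k) ⟩
    ((g ∙ k) ∙ h) ∙ (k ⁻¹ ∙ g ⁻¹)       ≈⟨ assoc ((g ∙ k) ∙ h) (k ⁻¹) (g ⁻¹) ⟨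
    (((g ∙ k) ∙ h) ∙ k ⁻¹) ∙ g ⁻¹       ≈⟨ ∙-congʳ (∙-congʳ (assoc g k h)) ⟩
    ((g ∙ (k ∙ h)) ∙ k ⁻¹) ∙ g ⁻¹       ≈⟨ ∙-congʳ (assoc g (k ∙ h) (k ⁻¹)) ⟩
    (g ∙ conj k h) ∙ g ⁻¹               ∎

  conj-inverse : ∀ k h → conj (k ⁻¹) (conj k h) ≈ h
  conj-inverse k h = begin
    (k ⁻¹ ∙ ((k ∙ h) ∙ k ⁻¹)) ∙ k ⁻¹ ⁻¹ ≈⟨ ∙-congʳ (∙-congˡ (assoc k h (k ⁻¹))) ⟩
    (k ⁻¹ ∙ (k ∙ (h ∙ k ⁻¹))) ∙ k ⁻¹ ⁻¹ ≈⟨ ∙-congʳ (\\-leftDividesʳ k (h ∙ k ⁻¹)) ⟩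
    (h ∙ k ⁻¹) ∙ k ⁻¹ ⁻¹                ≈⟨ //-rightDividesʳ (k ⁻¹) h ⟩
    h                                   ∎

  same-conj⇒commutes : ∀ g k h → conj g h ≈ conj k h
                     → (k ⁻¹ ∙ g) ∙ h ≈ h ∙ (k ⁻¹ ∙ g)
  same-conj⇒commutes g k h c_g≈c_k = begin
    (k ⁻¹ ∙ g) ∙ h                      ≈⟨ //-rightDividesˡ (k ⁻¹ ∙ g) ((k ⁻¹ ∙ g) ∙ h) ⟨
    conj (k ⁻¹ ∙ g) h ∙ (k ⁻¹ ∙ g)      ≈⟨ ∙-congʳ fixed ⟩
    h ∙ (k ⁻¹ ∙ g)                      ∎
    where
    fixed : conj (k ⁻¹ ∙ g) h ≈ h
    fixed = begin
      conj (k ⁻¹ ∙ g) h                 ≈⟨ conj-action (k ⁻¹) g h ⟩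
      conj (k ⁻¹) (conj g h)            ≈⟨ conj-cong (k ⁻¹) c_g≈c_k ⟩
      conj (k ⁻¹) (conj k h)            ≈⟨ conj-inverse k h ⟩
      h                                 ∎

module QuasiHomomorphism
  {a ℓa b ℓb : Level} (Γ : Group a ℓa) (G : Group b ℓb)
  (ρ : Group.Carrier Γ → Group.Carrier G) (ρ-resp : Respects≈ Γ G ρ)
  (φ : Group.Carrier Γ → Group.Carrier G) (φ-witness : QuasiWitness Γ G ρ φ)
  where
  private module Γ = Group Γ
  open Group G
  open GroupProperties G using (\\-leftDividesˡ; ∙-cancelˡ)
  open Conjugation G
  open SetoidReasoning setoid

  twisted-homo : ∀ x y → ρ (x Γ.∙ y) ≈ ρ x ∙ conj (φ x) (ρ y)
  twisted-homo x y = begin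
    ρ (x Γ.∙ y)                         ≈⟨ \\-leftDividesˡ (ρ x) (ρ (x Γ.∙ y)) ⟨
    ρ x ∙ (ρ x ⁻¹ ∙ ρ (x Γ.∙ y))        ≈⟨ ∙-congˡ (φ-witness x y) ⟩
    ρ x ∙ conj (φ x) (ρ y)              ∎

  expand-right-nested : ∀ x y z →
    ρ (x Γ.∙ (y Γ.∙ z)) ≈ ρ x ∙ (conj (φ x) (ρ y) ∙ conj (φ x ∙ φ y) (ρ z))
  expand-right-nested x y z = begin
    ρ (x Γ.∙ (y Γ.∙ z))                              ≈⟨ twisted-homo x (y Γ.∙ z) ⟩
    ρ x ∙ conj (φ x) (ρ (y Γ.∙ z))                   ≈⟨ ∙-congˡ (conj-cong (φ x) (twisted-homo y z)) ⟩
    ρ x ∙ conj (φ x) (ρ y ∙ conj (φ y) (ρ z))        ≈⟨ ∙-congˡ (conj-homo (φ x) (ρ y) _) ⟩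
    ρ x ∙ (conj (φ x) (ρ y) ∙ conj (φ x) (conj (φ y) (ρ z)))
                                                     ≈⟨ ∙-congˡ (∙-congˡ (conj-action (φ x) (φ y) (ρ z))) ⟨
    ρ x ∙ (conj (φ x) (ρ y) ∙ conj (φ x ∙ φ y) (ρ z)) ∎

  expand-left-nested : ∀ x y z →
    ρ ((x Γ.∙ y) Γ.∙ z) ≈ ρ x ∙ (conj (φ x) (ρ y) ∙ conj (φ (x Γ.∙ y)) (ρ z))
  expand-left-nested x y z = begin
    ρ ((x Γ.∙ y) Γ.∙ z)                              ≈⟨ twisted-homo (x Γ.∙ y) z ⟩
    ρ (x Γ.∙ y) ∙ conj (φ (x Γ.∙ y)) (ρ z)           ≈⟨ ∙-congʳ (twisted-homo x y) ⟩
    (ρ x ∙ conj (φ x) (ρ y)) ∙ conj (φ (x Γ.∙ y)) (ρ z)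
                                                     ≈⟨ assoc (ρ x) _ _ ⟩
    ρ x ∙ (conj (φ x) (ρ y) ∙ conj (φ (x Γ.∙ y)) (ρ z)) ∎

  -- Associativity in Γ forces c_{φ(x)φ(y)} = c_{φ(xy)} on ρ(Γ).
  witness-homo-on-image : ∀ x y z →
    conj (φ x ∙ φ y) (ρ z) ≈ conj (φ (x Γ.∙ y)) (ρ z)
  witness-homo-on-image x y z =
    ∙-cancelˡ (conj (φ x) (ρ y)) _ _ (∙-cancelˡ (ρ x) _ _ (begin
      ρ x ∙ (conj (φ x) (ρ y) ∙ conj (φ x ∙ φ y) (ρ z))  ≈⟨ expand-right-nested x y z ⟨
      ρ (x Γ.∙ (y Γ.∙ z))                                ≈⟨ ρ-resp (Γ.assoc x y z) ⟨
      ρ ((x Γ.∙ y) Γ.∙ z)                                ≈⟨ expand-left-nested x y z ⟩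
      ρ x ∙ (conj (φ x) (ρ y) ∙ conj (φ (x Γ.∙ y)) (ρ z)) ∎))

  -- Hence φ is multiplicative modulo the centralizer of ρ(Γ).
  cocycle-central : ∀ x y →
    InCentralizer Γ G ρ ((φ (x Γ.∙ y) ⁻¹ ∙ φ x) ∙ φ y)
  cocycle-central x y z = begin
    ((φ (x Γ.∙ y) ⁻¹ ∙ φ x) ∙ φ y) ∙ ρ z  ≈⟨ ∙-congʳ (assoc _ (φ x) (φ y)) ⟩
    (φ (x Γ.∙ y) ⁻¹ ∙ (φ x ∙ φ y)) ∙ ρ z  ≈⟨ same-conj⇒commutes _ _ (ρ z) (witness-homo-on-image x y z) ⟩
    ρ z ∙ (φ (x Γ.∙ y) ⁻¹ ∙ (φ x ∙ φ y))  ≈⟨ ∙-congˡ (assoc _ (φ x) (φ y)) ⟨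
    ρ z ∙ ((φ (x Γ.∙ y) ⁻¹ ∙ φ x) ∙ φ y)  ∎

  -- Any other witness ψ acts on ρ(Γ) like φ, both acting as y ↦ ρ(x)⁻¹ρ(xy);
  -- hence φ and ψ agree modulo the centralizer of ρ(Γ).
  witnesses-differ-centrally : ∀ ψ → QuasiWitness Γ G ρ ψ →
    ∀ x → InCentralizer Γ G ρ (φ x ⁻¹ ∙ ψ x)
  witnesses-differ-centrally ψ ψ-witness x y =
    same-conj⇒commutes (ψ x) (φ x) (ρ y) (trans (sym (ψ-witness x y)) (φ-witness x y))

-- Opened only here, so that the modules above can open a fixed group unambiguously.
open Group using (Carrier; _∙_; _⁻¹)

mainTheorem1 : {a ℓa b ℓb : Level} (Γ : Group a ℓa) (G : Group b ℓb)
    → (ρ : Carrier Γ → Carrier G) → Respects≈ Γ G ρ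
    → (φ : Carrier Γ → Carrier G) → QuasiWitness Γ G ρ φ
    → (∀ x y → InCentralizer Γ G ρ
         (_∙_ G (_∙_ G (_⁻¹ G (φ (_∙_ Γ x y))) (φ x)) (φ y)))
      × (∀ (ψ : Carrier Γ → Carrier G) → QuasiWitness Γ G ρ ψ
           → ∀ x → InCentralizer Γ G ρ (_∙_ G (_⁻¹ G (φ x)) (ψ x)))
mainTheorem1 Γ G ρ ρ-resp φ φ-witness = cocycle-central , witnesses-differ-centrally
  where open QuasiHomomorphism Γ G ρ ρ-resp φ φ-witness
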